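{- Let $(P,\le)$ be a poset with top element $1$, let $a,b\in P$, let $\Theta$ be a congruence on $(P,\le)$ and put $F:=[1]\Theta$. Then: (i) if $a,b\in F$ then $\operatorname{Max}L(a,b)\cap F\ne\emptyset$; (ii) if $b\in F$ then $\operatorname{Max}L(a,b)\cap[a]\Theta\ne\emptyset$; (iii) if $a\in F$ then $\operatorname{Min}U(a,b)\cap F\ne\emptyset$; (iv) $F$ is a strong filter of $(P,\le)$.
   Context: For a poset $(P,\le)$ and $x,y\in P$ let $L(x,y)=\{z\in P\mid z\le x,\ z\le y\}$ and $U(x,y)=\{z\in P\mid x\le z,\ y\le z\}$; for $A\subseteq P$, $\operatorname{Max}A$ and $\operatorname{Min}A$ denote the sets of maximal and minimal elements of $A$. A binary relation $R$ on $P$ is compatible with a map $Q\colon P^2\to 2^P$ if whenever $(a_1,b_1),(a_2,b_2)\in R$ there exist $a\in Q(a_1,a_2)$ and $b\in Q(b_1,b_2)$ with $(a,b)\in R$. A congruence on $(P,\le)$ is an equivalence relation on $P$ compatible with both $(x,y)\mapsto\operatorname{Max}L(x,y)$ and $(x,y)\mapsto\operatorname{Min}U(x,y)$. A filter of $(P,\le)$ is a nonempty subset $F$ such that $x\in F$, $y\in P$, $x\le y$ imply $y\in F$; it is a strong filter if moreover $L(x,y)\cap F\ne\emptyset$ for all $x,y\in F$. -}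

module Defs where

open import Level using (Level; _⊔_)
open import Data.Product using (_×_; ∃-syntax; Σ-syntax)
open import Relation.Binary.Core using (Rel)
open import Relation.Binary.Structures using (IsPartialOrder; IsEquivalence)
open import Relation.Binary.PropositionalEquality using (_≡_)

IsPoset : ∀ {a ℓ} {A : Set a} → Rel A ℓ → Set (a ⊔ ℓ)
IsPoset _≤_ = IsPartialOrder _≡_ _≤_

IsTop : ∀ {a ℓ} {A : Set a} → Rel A ℓ → A → Set (a ⊔ ℓ)
IsTop _≤_ t = ∀ x → x ≤ t

L : ∀ {a ℓ} {A : Set a} → Rel A ℓ → A → A → A → Set ℓ
L _≤_ x y z = (z ≤ x) × (z ≤ y)

U : ∀ {a ℓ} {A : Set a} → Rel A ℓ → A → A → A → Set ℓ
U _≤_ x y z = (x ≤ z) × (y ≤ z)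

Max : ∀ {a ℓ ℓ'} {A : Set a} → Rel A ℓ → (A → Set ℓ') → A → Set (a ⊔ ℓ ⊔ ℓ')
Max _≤_ S z = S z × (∀ w → S w → z ≤ w → w ≡ z)

Min : ∀ {a ℓ ℓ'} {A : Set a} → Rel A ℓ → (A → Set ℓ') → A → Set (a ⊔ ℓ ⊔ ℓ')
Min _≤_ S z = S z × (∀ w → S w → w ≤ z → w ≡ z)

-- R is compatible with Q : P² → 2^P  (Q x y z means z ∈ Q(x,y))
Compatible : ∀ {a ℓ ℓ'} {A : Set a} → Rel A ℓ → (A → A → A → Set ℓ') → Set (a ⊔ ℓ ⊔ ℓ')
Compatible R Q = ∀ a₁ b₁ a₂ b₂ → R a₁ b₁ → R a₂ b₂ →
  ∃[ x ] ∃[ y ] (Q a₁ a₂ x × Q b₁ b₂ y × R x y)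

IsCongruence : ∀ {a ℓ ℓ'} {A : Set a} → Rel A ℓ → Rel A ℓ' → Set (a ⊔ ℓ ⊔ ℓ')
IsCongruence _≤_ Θ =
  IsEquivalence Θ
  × Compatible Θ (λ x y → Max _≤_ (L _≤_ x y))
  × Compatible Θ (λ x y → Min _≤_ (U _≤_ x y))

Class : ∀ {a ℓ'} {A : Set a} → Rel A ℓ' → A → A → Set ℓ'
Class Θ x z = Θ x z

IsFilter : ∀ {a ℓ ℓ'} {A : Set a} → Rel A ℓ → (A → Set ℓ') → Set (a ⊔ ℓ ⊔ ℓ')
IsFilter _≤_ F = (∃[ x ] F x) × (∀ x y → F x → x ≤ y → F y)

IsStrongFilter : ∀ {a ℓ ℓ'} {A : Set a} → Rel A ℓ → (A → Set ℓ') → Set (a ⊔ ℓ ⊔ ℓ')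
IsStrongFilter _≤_ F =
  IsFilter _≤_ F × (∀ x y → F x → F y → ∃[ z ] (L _≤_ x y z × F z))

{-# OPTIONS --safe #-}
-- Compatibility applied to Θ-related pairs (a₁,b₁), (a₂,b₂) yields an element of
-- Q(b₁,b₂) Θ-related to an element of Q(a₁,a₂). Choosing a₁ ≤ a₂ or a₂ ≤ a₁ (using the
-- top or reflexivity) makes Max L(a₁,a₂) resp. Min U(a₁,a₂) a singleton, so that element
-- is known and the one in Q(b₁,b₂) lies in the wanted class.
module Submission where

open import Defs
open import Data.Product using (_×_; ∃-syntax; _,_; proj₁; proj₂)
open import Relation.Binary.Core using (Rel)
open import Relation.Binary.Definitions using (Reflexive)
open import Relation.Binary.Structures using (IsPartialOrder; IsEquivalence)
open import Relation.Binary.PropositionalEquality using (_≡_; sym; subst)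

module _ {a ℓ} {A : Set a} {_≤_ : Rel A ℓ} (≤-refl : Reflexive _≤_) where

  Max-L-≤ : ∀ {x y z} → x ≤ y → Max _≤_ (L _≤_ x y) z → z ≡ x
  Max-L-≤ x≤y ((z≤x , _) , maximal) = sym (maximal _ (≤-refl , x≤y) z≤x)

  Min-U-≤ : ∀ {x y z} → x ≤ y → Min _≤_ (U _≤_ x y) z → z ≡ y
  Min-U-≤ x≤y ((_ , y≤z) , minimal) = sym (minimal _ (x≤y , ≤-refl) y≤z)

  Min-U-≥ : ∀ {x y z} → y ≤ x → Min _≤_ (U _≤_ x y) z → z ≡ x
  Min-U-≥ y≤x ((x≤z , _) , minimal) = sym (minimal _ (≤-refl , y≤x) x≤z)

compatible-at-singleton : ∀ {a ℓ ℓ'} {A : Set a} {Θ : Rel A ℓ} {Q : A → A → A → Set ℓ'} →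
  Compatible Θ Q → ∀ {a₁ b₁ a₂ b₂ c} → Θ a₁ b₁ → Θ a₂ b₂ →
  (∀ {p} → Q a₁ a₂ p → p ≡ c) → ∃[ q ] (Q b₁ b₂ q × Θ c q)
compatible-at-singleton {Θ = Θ} compatible θ₁ θ₂ Q⊆c with compatible _ _ _ _ θ₁ θ₂
... | p , q , p∈Q , q∈Q , θpq = q , q∈Q , subst (λ t → Θ t q) (Q⊆c p∈Q) θpq

module _ {a ℓ ℓ'} {A : Set a} {_≤_ : Rel A ℓ} (≤-refl : Reflexive _≤_)
  {one : A} (top : IsTop _≤_ one) {Θ : Rel A ℓ'} (congruence : IsCongruence _≤_ Θ) where

  private
    module Θ = IsEquivalence (proj₁ congruence)
    compatible-Max-L = proj₁ (proj₂ congruence)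
    compatible-Min-U = proj₂ (proj₂ congruence)

  Max-L-in-top-class : ∀ {x y} → Θ one x → Θ one y → ∃[ z ] (Max _≤_ (L _≤_ x y) z × Θ one z)
  Max-L-in-top-class θx θy =
    compatible-at-singleton compatible-Max-L θx θy (Max-L-≤ ≤-refl ≤-refl)

  Max-L-in-class : ∀ {x y} → Θ one y → ∃[ z ] (Max _≤_ (L _≤_ x y) z × Θ x z)
  Max-L-in-class {x} θy =
    compatible-at-singleton compatible-Max-L Θ.refl θy (Max-L-≤ ≤-refl (top x))

  Min-U-in-top-class : ∀ {x y} → Θ one x → ∃[ z ] (Min _≤_ (U _≤_ x y) z × Θ one z)
  Min-U-in-top-class {y = y} θx =
    compatible-at-singleton compatible-Min-U θx Θ.refl (Min-U-≥ ≤-refl (top y))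

  top-class-upward-closed : ∀ {x y} → Θ one x → x ≤ y → Θ one y
  top-class-upward-closed θx x≤y with Min-U-in-top-class θx
  ... | z , z∈MinU , θz = subst (Θ one) (Min-U-≤ ≤-refl x≤y z∈MinU) θz

  top-class-strong-filter : IsStrongFilter _≤_ (Class Θ one)
  top-class-strong-filter =
    ((one , Θ.refl) , λ _ _ → top-class-upward-closed) ,
    λ _ _ θx θy → let z , (z∈L , _) , θz = Max-L-in-top-class θx θy in z , z∈L , θz

corollary3p9 : ∀ {a ℓ ℓ'} {A : Set a} (_≤_ : Rel A ℓ) → IsPoset _≤_ →
    (one : A) → IsTop _≤_ one → (x y : A) (Θ : Rel A ℓ') → IsCongruence _≤_ Θ →
    ((Class Θ one x → Class Θ one y → ∃[ z ] (Max _≤_ (L _≤_ x y) z × Class Θ one z))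
    × (Class Θ one y → ∃[ z ] (Max _≤_ (L _≤_ x y) z × Class Θ x z))
    × (Class Θ one x → ∃[ z ] (Min _≤_ (U _≤_ x y) z × Class Θ one z))
    × IsStrongFilter _≤_ (Class Θ one))
corollary3p9 _≤_ poset one top x y Θ congruence =
  Max-L-in-top-class ≤-refl top congruence ,
  Max-L-in-class ≤-refl top congruence ,
  Min-U-in-top-class ≤-refl top congruence ,
  top-class-strong-filter ≤-refl top congruence
  where ≤-refl = IsPartialOrder.refl poset
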